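{- Consider the following proof-producing variant of the Dutertre–de Moura simplex procedure for linear rational arithmetic. The input is a finite set of inequalities, each of the form $l_k \le \sum_h \hat a_{kh} y_h$ or $u_k \ge \sum_h \hat a_{kh} y_h$ over rational variables $y_h$ with rational constants $l_k,u_k,\hat a_{kh}$. For every distinct term $\sum_h \hat a_{kh} y_h$ occurring in the input, a fresh slack variable $s_k$ is introduced: every input inequality is replaced by the corresponding elementary atom $l_k \le s_k$ (resp. $u_k \ge s_k$), and the equation $s_k = \sum_h \hat a_{kh} y_h$ is added. Initially the set of basic variables $\mathcal B$ is the set of slack variables and the set of non-basic variables $\mathcal N$ is the set of the $y_h$'s. The procedure maintains a tableau $T = \{ x_i = \sum_{x_j\in\mathcal N} a_{ij} x_j \mid x_i \in \mathcal B\}$, obtained from the initial one by pivoting so that it always has exactly the same rational solutions as the initial set of equations, together with an assignment $\beta$ with $\beta(x_i)=\sum_{x_j\in\mathcal N} a_{ij}\beta(x_j)$ for $x_i\in\mathcal B$ and with every non-basic variable within its current bounds. Suppose that the procedure reports a conflict from the row $x_i = \sum_{x_j\in\mathcal N} a_{ij}x_j$ of the current tableau because of an elementary atom $x_i \ge l_i$, i.e. $\beta(x_i) < l_i$, and, writing $\mathcal N^+ = \{x_j\in\mathcal N \mid a_{ij}>0\}$ and $\mathcal N^- = \{x_j\in\mathcal N\mid a_{ij}<0\}$, for every $x_j\in\mathcal N^+$ there is an elementary atom $x_j\le u_j$ with $\beta(x_j)=u_j$, and for every $x_j\in\mathcal N^-$ there is an elementary atom $x_j \ge l_j$ with $\beta(x_j)=l_j$.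 Let $$\eta = \{x_j \le u_j \mid x_j\in\mathcal N^+\}\cup\{x_j\ge l_j\mid x_j\in\mathcal N^-\}\cup\{x_i\ge l_i\}.$$ Then $x_i$ and all the $x_j$ occurring in $\eta$ are slack variables introduced by the preprocessing step. Moreover, the set $\eta' = \eta_{\mathcal N^+}\cup\eta_{\mathcal N^- }\cup\eta_i$, where $\eta_{\mathcal N^+} = \{u_k \ge \sum_h \hat a_{kh}y_h \mid s_k \equiv x_j,\ x_j\in\mathcal N^+\}$, $\eta_{\mathcal N^- } = \{l_k \le \sum_h \hat a_{kh}y_h \mid s_k\equiv x_j,\ x_j\in\mathcal N^-\}$, $\eta_i = \{l_k\le \sum_h \hat a_{kh}y_h \mid s_k\equiv x_i\}$, is a conflict set, i.e. it is unsatisfiable over the rationals.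
   Context: Here $s_k \equiv x_j$ means that the variable $x_j$ is the slack variable $s_k$ associated with the term $\sum_h \hat a_{kh} y_h$; thus $\eta'$ is obtained from $\eta$ by replacing each elementary atom on a slack variable by the corresponding original input inequality. -}

module Defs where

open import Data.Nat using (ℕ; zero; suc)
open import Data.Fin using (Fin; zero; suc)
open import Data.Vec using (Vec; lookup)
open import Data.Bool using (Bool; true; false; if_then_else_)
open import Data.Sum using (_⊎_; inj₁; inj₂)
open import Data.Product using (Σ; ∃; _×_; _,_)
open import Data.List using (List)
open import Data.List.Membership.Propositional using (_∈_)
open import Data.Rational using (ℚ; 0ℚ; _+_; _*_; _≤_; _<_)
open import Relation.Binary.PropositionalEquality using (_≡_)
open import Data.Empty using (⊥)

sumFin : ∀ {n} → (Fin n → ℚ) → ℚ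
sumFin {zero}  f = 0ℚ
sumFin {suc n} f = f zero + sumFin (λ i → f (suc i))

-- Variables after preprocessing: inj₁ k is the slack variable s_k
-- (one per distinct input term, k : Fin n), inj₂ h is the original y_h.
Var : ℕ → ℕ → Set
Var n m = Fin n ⊎ Fin m

IsSlack : ∀ {n m} → Var n m → Set
IsSlack {n} x = Σ (Fin n) λ k → x ≡ inj₁ k

sumVar : ∀ {n m} → (Var n m → ℚ) → ℚ
sumVar f = sumFin (λ k → f (inj₁ k)) + sumFin (λ h → f (inj₂ h))

-- lower: bound ≤ (term) ; upper: bound ≥ (term)
data Kind : Set where
  lower upper : Kind

record Ineq (m : ℕ) : Set where
  constructor ineq
  field
    kind   : Kind
    coeffs : Vec ℚ m
    const  : ℚ
open Ineq public

termValue : ∀ {m} → Vec ℚ m → (Fin m → ℚ) → ℚ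
termValue c y = sumFin (λ h → lookup c h * y h)

SatIneq : ∀ {m} → Ineq m → (Fin m → ℚ) → Set
SatIneq (ineq lower c b) y = b ≤ termValue c y
SatIneq (ineq upper c b) y = termValue c y ≤ b

record Atom (n m : ℕ) : Set where
  constructor atom
  field
    akind  : Kind
    avar   : Var n m
    aconst : ℚ
open Atom public

SatAtom : ∀ {n m} → Atom n m → (Var n m → ℚ) → Set
SatAtom (atom lower x b) v = b ≤ v x
SatAtom (atom upper x b) v = v x ≤ b

-- Preprocessing. The distinct terms occurring in the input are
-- termOf : Fin n → Vec ℚ m (slack s_k stands for termOf k).
DistinctTerms : ∀ {n m} → (Fin n → Vec ℚ m) → Set
DistinctTerms {n} termOf = (k k′ : Fin n) → termOf k ≡ termOf k′ → k ≡ k′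

TermsOfInput : ∀ {n m} → (Fin n → Vec ℚ m) → List (Ineq m) → Set
TermsOfInput {n} {m} termOf input =
  ((ι : Ineq m) → ι ∈ input → Σ (Fin n) λ k → termOf k ≡ coeffs ι) ×
  ((k : Fin n) → Σ (Ineq m) λ ι → ι ∈ input × coeffs ι ≡ termOf k)

ElemAtomOf : ∀ {n m} → (Fin n → Vec ℚ m) → Ineq m → Atom n m → Set
ElemAtomOf {n} termOf ι α =
  Σ (Fin n) λ k → termOf k ≡ coeffs ι × α ≡ atom (kind ι) (inj₁ k) (const ι)

ElemAtom : ∀ {n m} → (Fin n → Vec ℚ m) → List (Ineq m) → Atom n m → Set
ElemAtom {n} {m} termOf input α =
  Σ (Ineq m) λ ι → ι ∈ input × ElemAtomOf termOf ι α

InitialEqs : ∀ {n m} → (Fin n → Vec ℚ m) → (Var n m → ℚ) → Set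
InitialEqs {n} termOf v =
  (k : Fin n) → v (inj₁ k) ≡ termValue (termOf k) (λ h → v (inj₂ h))

-- A tableau: basic variables (basic x ≡ true), and for each basic x_i the
-- row  x_i = Σ_{x_j ∈ N} a x_i x_j · x_j  (entries at basic x_j are ignored).
rowValue : ∀ {n m} → (Var n m → Bool) → (Var n m → Var n m → ℚ) →
           Var n m → (Var n m → ℚ) → ℚ
rowValue basic a i v = sumVar (λ j → if basic j then 0ℚ else a i j * v j)

SatTableau : ∀ {n m} → (Var n m → Bool) → (Var n m → Var n m → ℚ) →
             (Var n m → ℚ) → Set
SatTableau {n} {m} basic a v =
  (i : Var n m) → basic i ≡ true → v i ≡ rowValue basic a i v

EquivTableau : ∀ {n m} → (Fin n → Vec ℚ m) → (Var n m → Bool) →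
               (Var n m → Var n m → ℚ) → Set
EquivTableau {n} {m} termOf basic a =
  (v : Var n m → ℚ) →
  (SatTableau basic a v → InitialEqs termOf v) × (InitialEqs termOf v → SatTableau basic a v)

InEta : ∀ {n m} → (Var n m → Bool) → (Var n m → Var n m → ℚ) → (Var n m → ℚ) →
        Var n m → ℚ → Atom n m → Set
InEta {n} {m} basic a β xi li α =
  (α ≡ atom lower xi li) ⊎
  (Σ (Var n m) λ xj → basic xj ≡ false × 0ℚ < a xi xj × α ≡ atom upper xj (β xj)) ⊎
  (Σ (Var n m) λ xj → basic xj ≡ false × a xi xj < 0ℚ × α ≡ atom lower xj (β xj))

InEta′ : ∀ {n m} → (Fin n → Vec ℚ m) → (Var n m → Bool) → (Var n m → Var n m → ℚ) →
         (Var n m → ℚ) → Var n m → ℚ → Ineq m → Set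
InEta′ {n} {m} termOf basic a β xi li ι =
  Σ (Atom n m) λ α → ElemAtomOf termOf ι α × InEta basic a β xi li α

Unsat : ∀ {m} → List (Ineq m) → (Ineq m → Set) → Set
Unsat {m} input P =
  (y : Fin m → ℚ) → ((ι : Ineq m) → ι ∈ input → P ι → SatIneq ι y) → ⊥

module Submission where

-- Every input inequality in η′ holds for y exactly when its elementary atom
-- holds for the extension of y that gives each slack s_k the value of its
-- term. That extension solves the initial equations, hence the current
-- tableau, so the row of x_i bounds its value: the atoms of η on the
-- non-basic x_j push each summand a_ij x_j below a_ij β(x_j), giving
-- l_i ≤ x_i ≤ Σ a_ij β(x_j) = β(x_i) < l_i.

open import Defs
open import Data.Nat using (ℕ)
open import Data.Fin using (Fin; zero; suc)
open import Data.Vec using (Vec)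
open import Data.Bool using (Bool; true; false; if_then_else_)
open import Data.Product using (_×_; _,_; proj₂)
open import Data.Sum using (inj₁; inj₂)
open import Data.List using (List)
open import Data.List.Membership.Propositional using (_∈_)
open import Data.List.Relation.Unary.All using (All)
open import Data.Rational using (ℚ; 0ℚ; _*_; _≤_; _<_; positive; negative)
open import Data.Rational.Properties
  using (≤-refl; <-irrefl; <-cmp; +-mono-≤; *-zeroˡ;
         *-monoˡ-≤-nonNeg; *-monoˡ-≤-nonPos; pos⇒nonNeg; neg⇒nonPos; module ≤-Reasoning)
open import Relation.Binary.Definitions using (tri<; tri≈; tri>)
open import Relation.Binary.PropositionalEquality using (_≡_; refl; sym)
open import Data.Empty using (⊥)
open import Function using (_$_)

sumFin-mono-≤ : ∀ {k} (f g : Fin k → ℚ) → (∀ i → f i ≤ g i) → sumFin f ≤ sumFin g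
sumFin-mono-≤ {ℕ.zero}  f g f≤g = ≤-refl
sumFin-mono-≤ {ℕ.suc k} f g f≤g =
  +-mono-≤ (f≤g zero) (sumFin-mono-≤ (λ i → f (suc i)) (λ i → g (suc i)) (λ i → f≤g (suc i)))

sumVar-mono-≤ : ∀ {n m} (f g : Var n m → ℚ) → (∀ x → f x ≤ g x) → sumVar f ≤ sumVar g
sumVar-mono-≤ f g f≤g =
  +-mono-≤ (sumFin-mono-≤ _ _ (λ k → f≤g (inj₁ k))) (sumFin-mono-≤ _ _ (λ h → f≤g (inj₂ h)))

*-mono-≤-bySign : ∀ c {p q} → (0ℚ < c → p ≤ q) → (c < 0ℚ → q ≤ p) → c * p ≤ c * q
*-mono-≤-bySign c {p} {q} pos neg with <-cmp 0ℚ c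
... | tri< 0<c _ _ = *-monoˡ-≤-nonNeg c {{pos⇒nonNeg c {{positive 0<c}}}} (pos 0<c)
... | tri> _ _ c<0 = *-monoˡ-≤-nonPos c {{neg⇒nonPos c {{negative c<0}}}} (neg c<0)
... | tri≈ _ refl _ rewrite *-zeroˡ p | *-zeroˡ q = ≤-refl

rowValue-mono-≤ : ∀ {n m} (basic : Var n m → Bool) (a : Var n m → Var n m → ℚ) i
  (v w : Var n m → ℚ) → (∀ j → basic j ≡ false → a i j * v j ≤ a i j * w j) →
  rowValue basic a i v ≤ rowValue basic a i w
rowValue-mono-≤ basic a i v w summand≤ = sumVar-mono-≤ _ _ summand≤′
  where
  summand≤′ : ∀ j → (if basic j then 0ℚ else a i j * v j) ≤ (if basic j then 0ℚ else a i j * w j)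
  summand≤′ j with basic j in eq
  ... | true  = ≤-refl
  ... | false = summand≤ j eq

elemAtom-isSlack : ∀ {n m} {termOf : Fin n → Vec ℚ m} {input} {α : Atom n m} →
  ElemAtom termOf input α → IsSlack (avar α)
elemAtom-isSlack (_ , _ , k , _ , refl) = k , refl

slackExtension : ∀ {n m} → (Fin n → Vec ℚ m) → (Fin m → ℚ) → Var n m → ℚ
slackExtension termOf y (inj₁ k) = termValue (termOf k) y
slackExtension termOf y (inj₂ h) = y h

slackExtension-initialEqs : ∀ {n m} (termOf : Fin n → Vec ℚ m) (y : Fin m → ℚ) →
  InitialEqs termOf (slackExtension termOf y)
slackExtension-initialEqs termOf y k = refl

elemAtomOf-sat : ∀ {n m} (termOf : Fin n → Vec ℚ m) (y : Fin m → ℚ) ι {α : Atom n m} →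
  ElemAtomOf termOf ι α → SatIneq ι y → SatAtom α (slackExtension termOf y)
elemAtomOf-sat termOf y (ineq lower c b) (k , refl , refl) sat = sat
elemAtomOf-sat termOf y (ineq upper c b) (k , refl , refl) sat = sat

tableauRow-conflict : ∀ {n m} (basic : Var n m → Bool) (a : Var n m → Var n m → ℚ)
  {v β : Var n m → ℚ} → SatTableau basic a v → SatTableau basic a β →
  ∀ {xi li} → basic xi ≡ true → li ≤ v xi → β xi < li →
  (∀ j → basic j ≡ false → a xi j * v j ≤ a xi j * β j) → ⊥
tableauRow-conflict basic a {v} {β} satv satβ {xi} {li} xi-basic li≤v β<li summand≤ = <-irrefl refl $ begin-strict
  li                       ≤⟨ li≤v ⟩
  v xi                     ≡⟨ satv xi xi-basic ⟩
  rowValue basic a xi v    ≤⟨ rowValue-mono-≤ basic a xi v β summand≤ ⟩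
  rowValue basic a xi β    ≡⟨ sym (satβ xi xi-basic) ⟩
  β xi                     <⟨ β<li ⟩
  li                       ∎
  where open ≤-Reasoning

mainTheorem1 : (n m : ℕ) (termOf : Fin n → Vec ℚ m) (input : List (Ineq m)) →
    DistinctTerms termOf → TermsOfInput termOf input →
    (basic : Var n m → Bool) (a : Var n m → Var n m → ℚ) →
    EquivTableau termOf basic a →
    (asserted : List (Atom n m)) → All (ElemAtom termOf input) asserted →
    (β : Var n m → ℚ) → SatTableau basic a β →
    ((xj : Var n m) → basic xj ≡ false → (α : Atom n m) → α ∈ asserted →
      avar α ≡ xj → SatAtom α β) →
    (xi : Var n m) → basic xi ≡ true → (li : ℚ) →
    ElemAtom termOf input (atom lower xi li) → β xi < li →
    ((xj : Var n m) → basic xj ≡ false → 0ℚ < a xi xj →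
      ElemAtom termOf input (atom upper xj (β xj))) →
    ((xj : Var n m) → basic xj ≡ false → a xi xj < 0ℚ →
      ElemAtom termOf input (atom lower xj (β xj))) →
    ((α : Atom n m) → InEta basic a β xi li α → IsSlack (avar α)) ×
    Unsat input (InEta′ termOf basic a β xi li)
mainTheorem1 n m termOf input _ _ basic a equiv _ _ β satβ _ xi xi-basic li lowerᵢ β<li upperⱼ lowerⱼ =
  η-slack , η′-unsat
  where
  η-elem : (α : Atom n m) → InEta basic a β xi li α → ElemAtom termOf input α
  η-elem α (inj₁ refl)                       = lowerᵢ
  η-elem α (inj₂ (inj₁ (j , nb , p , refl))) = upperⱼ j nb p
  η-elem α (inj₂ (inj₂ (j , nb , p , refl))) = lowerⱼ j nb p

  η-slack : (α : Atom n m) → InEta basic a β xi li α → IsSlack (avar α)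
  η-slack α α∈η = elemAtom-isSlack (η-elem α α∈η)

  η′-unsat : Unsat input (InEta′ termOf basic a β xi li)
  η′-unsat y η′-sat =
    tableauRow-conflict basic a (proj₂ (equiv v) (slackExtension-initialEqs termOf y)) satβ
      xi-basic (η-sat _ (inj₁ refl)) β<li summand≤
    where
    v : Var n m → ℚ
    v = slackExtension termOf y

    η-sat : (α : Atom n m) → InEta basic a β xi li α → SatAtom α v
    η-sat α α∈η with η-elem α α∈η
    ... | ι , ι∈input , α-of-ι = elemAtomOf-sat termOf y ι α-of-ι (η′-sat ι ι∈input (α , α-of-ι , α∈η))

    summand≤ : ∀ j → basic j ≡ false → a xi j * v j ≤ a xi j * β j
    summand≤ j nb = *-mono-≤-bySign (a xi j)
      (λ p → η-sat _ (inj₂ (inj₁ (j , nb , p , refl))))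
      (λ p → η-sat _ (inj₂ (inj₂ (j , nb , p , refl))))
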